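{- Let $d\ge 1$, let $B^*$ be a subdivision of the complete binary tree $B_d$, and let $C\colon V(B^*)\to\{1,\dots,k\}$ be an arbitrary coloring. Then there exists a vector $a=(a_1,\dots,a_k)$ of nonnegative integers with $\sum_{i=1}^k a_i=d$ such that for every $i\in\{1,\dots,k\}$, $B^*$ contains (as a subgraph) a subdivision of $B_{a_i}$ all of whose branch vertices are colored $i$.
   Context: $B_m$ is the rooted complete binary tree with $m$ levels ($2^m-1$ vertices); $B_0$ is the empty tree. A graph $H$ is a subdivision of $G$ if $H$ is obtained by replacing every edge of $G$ by a path; the original vertices of $G$ in $H$ are the branch vertices. -}

module Defs where

open import Data.Nat using (ℕ; zero; suc; _<_; _≤_; s≤s)
open import Data.Nat.Properties using (<-trans; n<1+n)
open import Data.Bool using (Bool)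
open import Data.List using (List; []; _∷_; length)
open import Data.List.Membership.Propositional using (_∈_)
open import Data.List.Relation.Unary.Unique.Propositional using (Unique)
open import Data.Fin using (Fin; toℕ)
open import Data.Product using (Σ; _×_; _,_; proj₁)
open import Data.Sum using (_⊎_)
open import Relation.Binary.PropositionalEquality using (_≡_; _≢_)
open import Relation.Nullary using (¬_)

-- Graphs (simple, undirected: adjacency given as a relation; the
-- graphs we build are symmetric and loopless).

record Graph : Set₁ where
  field
    V   : Set
    Adj : V → V → Set
open Graph public

-- Vertices are binary words w of length < m (the root is [] ; the
-- children of w are true ∷ w and false ∷ w).  So B_m has 2^m - 1
-- vertices and B_0 is empty.  Edges: (w , b ∷ w) for b ∷ w a vertex.

BV : ℕ → Set
BV m = Σ (List Bool) (λ w → length w < m)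

parent< : ∀ {m} (b : Bool) (w : List Bool) → length (b ∷ w) < m → length w < m
parent< b w p = <-trans (n<1+n (length w)) p

-- A subdivision B* of B_d: the edge from w to b ∷ w is replaced by a
-- path with ℓ (b ∷ w) internal vertices (ℓ arbitrary).  Every
-- subdivision of B_d is isomorphic to Bstar d ℓ for some ℓ.

module _ (d : ℕ) (ℓ : List Bool → ℕ) where

  data SV : Set where
    branch : (w : List Bool) → length w < d → SV
    -- i-th internal vertex (counted from the parent w) on the path
    -- replacing the edge w — b ∷ w
    inner  : (b : Bool) (w : List Bool) → length (b ∷ w) < d →
             Fin (ℓ (b ∷ w)) → SV

  data Step : SV → SV → Set where
    s-bb : ∀ {b w p q} → ℓ (b ∷ w) ≡ 0 →
           Step (branch w p) (branch (b ∷ w) q)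
    s-bi : ∀ {b w p q} {i : Fin (ℓ (b ∷ w))} → toℕ i ≡ 0 →
           Step (branch w p) (inner b w q i)
    s-ii : ∀ {b w q q'} {i j : Fin (ℓ (b ∷ w))} → toℕ j ≡ suc (toℕ i) →
           Step (inner b w q i) (inner b w q' j)
    s-ib : ∀ {b w q q'} {i : Fin (ℓ (b ∷ w))} → suc (toℕ i) ≡ ℓ (b ∷ w) →
           Step (inner b w q i) (branch (b ∷ w) q')

Bstar : (d : ℕ) → (List Bool → ℕ) → Graph
Bstar d ℓ = record
  { V   = SV d ℓ
  ; Adj = λ x y → Step d ℓ x y ⊎ Step d ℓ y x
  }

Walk : (H : Graph) → V H → List (V H) → V H → Set
Walk H u []       v = Adj H u v
Walk H u (x ∷ xs) v = Adj H u x × Walk H x xs v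

record SubdivIn (m : ℕ) (H : Graph) (P : V H → Set) : Set where
  field
    φ        : BV m → V H
    φ-inj    : ∀ x y → φ x ≡ φ y → proj₁ x ≡ proj₁ y
    φ-col    : ∀ x → P (φ x)
    path     : (b : Bool) (w : List Bool) → length (b ∷ w) < m → List (V H)
    path-walk : ∀ b w (p : length (b ∷ w) < m) →
                Walk H (φ (w , parent< b w p)) (path b w p) (φ (b ∷ w , p))
    path-uniq : ∀ b w (p : length (b ∷ w) < m) → Unique (path b w p)
    path-avoid : ∀ b w (p : length (b ∷ w) < m) v → v ∈ path b w p →
                 ∀ x → φ x ≢ v
    path-disj : ∀ b w (p : length (b ∷ w) < m) b' w' (p' : length (b' ∷ w') < m) →
                (b ∷ w) ≢ (b' ∷ w') →
                ∀ v → v ∈ path b w p → ¬ (v ∈ path b' w' p')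

-- Call a vector a with sum a ≡ n a profile of a vertex u whose subtree in B_d has height n if,
-- for every colour i, the subtree of u contains a subdivided B_(a i) with branch vertices of
-- colour i, in which the two subtrees below each branch vertex lie below different children of
-- it.  Profiles are built from the leaves up.  Given profiles L and R of the two children of u:
-- if R j < L j for some j, then R with j-th entry increased is a profile of u, since the copy of
-- B_(R j + 1) is found below the child true ∷ u (whose profile is L); otherwise L ≤ R pointwise, and for the colour c of
-- u the vertex u joined to copies of B_(L c) below both children is a copy of B_(L c + 1), so L
-- with c-th entry increased is a profile.  The profile of the root gives the theorem.
--
-- Such a nested copy is realised in B* by routing each of its edges along the subdivided tree path
-- between the two branch vertices.  Every vertex x of B_d lying on one of these paths determines
-- the address of the lower end of that path (the function owner), and owner is a left inverse of
-- the placement of branch vertices; hence the paths are disjoint and avoid all other branch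
-- vertices.

module Submission where

open import Defs
open import Data.Nat using (ℕ; _≤_)
open import Data.Bool using (Bool)
open import Data.List using (List)
open import Data.Fin using (Fin)
open import Data.Vec using (Vec; sum; lookup)
open import Data.Product using (∃; _×_)
open import Relation.Binary.PropositionalEquality using (_≡_)

open import Data.Nat using (zero; suc; _+_; _<_; z≤n; s≤s)
open import Data.Nat.Properties
  using (≤-refl; ≤-reflexive; m≤n⇒m≤1+n; <-trans; <-irrefl; <⇒≱; m≤n+m; +-monoˡ-<;
         +-identityʳ; +-suc; ≮⇒≥; _<?_)
open import Data.Bool using (true; false) renaming (_≟_ to _≟ᵇ_)
open import Data.List using ([]; _∷_; length; _++_; _∷ʳ_; reverse; tabulate)
open import Data.List.Properties using (≡-dec; ∷-injectiveˡ; unfold-reverse; reverse-injective; length-reverse)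
open import Data.List.Membership.Propositional using (_∈_)
open import Data.List.Membership.Propositional.Properties using (∈-++⁻; ∈-tabulate⁻)
open import Data.List.Relation.Unary.Any using (here; there)
open import Data.List.Relation.Unary.All as All using (All; []; _∷_)
open import Data.List.Relation.Unary.AllPairs using ([]; _∷_)
open import Data.List.Relation.Unary.Unique.Propositional using (Unique)
import Data.Fin as Fin
open import Data.Fin using (toℕ) renaming (_≟_ to _≟ᶠ_)
open import Data.Fin.Properties using (any?)
import Data.Vec as Vec
open import Data.Vec using (replicate; updateAt)
open import Data.Vec.Properties using (lookup∘updateAt; lookup∘updateAt′; lookup-replicate)
open import Data.Product using (Σ; _,_)
open import Data.Sum using (inj₁; inj₂)
open import Data.Empty using (⊥; ⊥-elim)
open import Function using (_∘_)
open import Relation.Nullary using (Dec; yes; no)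
open import Relation.Binary.PropositionalEquality using (_≢_; refl; sym; trans; cong; subst; module ≡-Reasoning)

Word : Set
Word = List Bool

-- x ≼ y : x is an ancestor of y in the infinite binary tree of words, i.e. a suffix of y.
infix 4 _≼_ _≺_ _≺?_

data _≼_ (x : Word) : Word → Set where
  here  : x ≼ x
  there : ∀ {c y} → x ≼ y → x ≼ c ∷ y

_≺_ : Word → Word → Set
x ≺ y = Σ Bool λ c → c ∷ x ≼ y

≼-trans : ∀ {x y z} → x ≼ y → y ≼ z → x ≼ z
≼-trans p here      = p
≼-trans p (there q) = there (≼-trans p q)

≼-length : ∀ {x y} → x ≼ y → length x ≤ length y
≼-length here      = ≤-refl
≼-length (there p) = m≤n⇒m≤1+n (≼-length p)

≺⇒≼ : ∀ {x y} → x ≺ y → x ≼ y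
≺⇒≼ (_ , p) = ≼-trans (there here) p

≺⇒⋡ : ∀ {x y} → x ≺ y → y ≼ x → ⊥
≺⇒⋡ (_ , p) q = <⇒≱ (≼-length p) (≼-length q)

≼-unique : ∀ {a b y} → a ≼ y → b ≼ y → length a ≡ length b → a ≡ b
≼-unique here      here      _ = refl
≼-unique here      (there q) e = ⊥-elim (<⇒≱ (≤-reflexive e) (≼-length q))
≼-unique (there p) here      e = ⊥-elim (<⇒≱ (≤-reflexive (sym e)) (≼-length p))
≼-unique (there p) (there q) e = ≼-unique p q e

≺-direction : ∀ {c c' x y} → c ∷ x ≼ y → c' ∷ x ≼ y → c ≡ c'
≺-direction p q = ∷-injectiveˡ (≼-unique p q refl)

_≺?_ : (x y : Word) → Dec (x ≺ y)
x ≺? []    = no λ ()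
x ≺? c ∷ y with ≡-dec _≟ᵇ_ x y
... | yes refl = yes (c , here)
... | no x≢y with x ≺? y
...   | yes (c' , p) = yes (c' , there p)
...   | no x⊀y = no λ { (_ , here) → x≢y refl ; (c' , there p) → x⊀y (c' , p) }

sum-updateAt-suc : ∀ {n} (a : Vec ℕ n) j → sum (updateAt a j suc) ≡ suc (sum a)
sum-updateAt-suc (x Vec.∷ a) Fin.zero    = refl
sum-updateAt-suc (x Vec.∷ a) (Fin.suc j) = trans (cong (x +_) (sum-updateAt-suc a j)) (+-suc x (sum a))

sum-replicate-zero : ∀ n → sum (replicate n 0) ≡ 0
sum-replicate-zero zero    = refl
sum-replicate-zero (suc n) = sum-replicate-zero n

module _ {H : Graph} where

  Walk-++ : ∀ {s m t} xs ys → Walk H s xs m → Walk H m ys t → Walk H s (xs ++ m ∷ ys) t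
  Walk-++ []       ys e       w  = e , w
  Walk-++ (x ∷ xs) ys (e , w) w' = e , Walk-++ xs ys w w'

  Walk-tabulate : ∀ {n} (h : Fin n → V H) {s t} →
                  (n ≡ 0 → Adj H s t) →
                  (∀ j → toℕ j ≡ 0 → Adj H s (h j)) →
                  (∀ j j' → toℕ j' ≡ suc (toℕ j) → Adj H (h j) (h j')) →
                  (∀ j → suc (toℕ j) ≡ n → Adj H (h j) t) →
                  Walk H s (tabulate h) t
  Walk-tabulate {zero}  h empty first next last = empty refl
  Walk-tabulate {suc n} h empty first next last =
    first Fin.zero refl ,
    Walk-tabulate (h ∘ Fin.suc)
      (λ e → last Fin.zero (cong suc (sym e)))
      (λ j e → next Fin.zero (Fin.suc j) (cong suc e))
      (λ j j' e → next (Fin.suc j) (Fin.suc j') (cong suc e))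
      (λ j e → last (Fin.suc j) (cong suc e))

  module _ (rank : V H → ℕ) (rank-< : ∀ {x y} → Adj H x y → rank x < rank y) where

    Walk-rank< : ∀ {u xs v} → Walk H u xs v → rank u < rank v
    Walk-rank< {xs = []}     e       = rank-< e
    Walk-rank< {xs = _ ∷ xs} (e , w) = <-trans (rank-< e) (Walk-rank< {xs = xs} w)

    Walk-interior-below : ∀ {u xs v} → Walk H u xs v → All (λ x → rank x < rank v) xs
    Walk-interior-below {xs = []}     _       = []
    Walk-interior-below {xs = _ ∷ xs} (_ , w) = Walk-rank< {xs = xs} w ∷ Walk-interior-below {xs = xs} w

    Walk-interior-above : ∀ {u xs v} → Walk H u xs v → All (λ x → rank u < rank x) xs
    Walk-interior-above {xs = []}     _       = []
    Walk-interior-above {xs = _ ∷ xs} (e , w) =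
      rank-< e ∷ All.map (<-trans (rank-< e)) (Walk-interior-above {xs = xs} w)

    Walk-unique : ∀ {u xs v} → Walk H u xs v → Unique xs
    Walk-unique {xs = []}     _       = []
    Walk-unique {xs = _ ∷ xs} (_ , w) =
      All.map (λ lt eq → <-irrefl (cong rank eq) lt) (Walk-interior-above {xs = xs} w) ∷
      Walk-unique {xs = xs} w

module _ {d : ℕ} {ℓ : List Bool → ℕ} where

  Down : Graph
  Down = record { V = SV d ℓ ; Adj = Step d ℓ }

  Walk-Down⇒Walk : ∀ {u xs v} → Walk Down u xs v → Walk (Bstar d ℓ) u xs v
  Walk-Down⇒Walk {xs = []}     e       = inj₁ e
  Walk-Down⇒Walk {xs = _ ∷ xs} (e , w) = inj₁ e , Walk-Down⇒Walk {xs = xs} w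

  key : SV d ℓ → Word
  key (branch w _)    = w
  key (inner b w _ _) = b ∷ w

  branch-depth : Word → ℕ
  branch-depth []      = 0
  branch-depth (b ∷ w) = suc (ℓ (b ∷ w) + branch-depth w)

  depth : SV d ℓ → ℕ
  depth (branch w _)    = branch-depth w
  depth (inner _ w _ j) = suc (toℕ j + branch-depth w)

  Step-depth : ∀ {x y} → Step d ℓ x y → depth x < depth y
  Step-depth (s-bb _) = s≤s (m≤n+m _ _)
  Step-depth (s-bi _) = s≤s (m≤n+m _ _)
  Step-depth (s-ii e) = s≤s (+-monoˡ-< _ (≤-reflexive (sym e)))
  Step-depth (s-ib e) = s≤s (+-monoˡ-< _ (≤-reflexive e))

  inners : (b : Bool) (x : Word) → length (b ∷ x) < d → List (SV d ℓ)
  inners b x p = tabulate (inner b x p)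

  inners-walk : ∀ {b x} p px q → Walk Down (branch x px) (inners b x p) (branch (b ∷ x) q)
  inners-walk p _ _ = Walk-tabulate {H = Down} (inner _ _ p) s-bb (λ _ → s-bi) (λ _ _ → s-ii) (λ _ → s-ib)

  spine : ∀ {b x y} → b ∷ x ≼ y → length y < d → List (SV d ℓ)
  spine {b} {x} here              py = inners b x py
  spine         (there {c} {y} q) py = spine q (parent< c y py) ++ branch y (parent< c y py) ∷ inners c y py

  spine-walk : ∀ {b x y} (q : b ∷ x ≼ y) px py → Walk Down (branch x px) (spine q py) (branch y py)
  spine-walk here              px py = inners-walk py px py
  spine-walk (there {c} {y} q) px py =
    Walk-++ (spine q _) _ (spine-walk q px (parent< c y py)) (inners-walk py _ py)

  spine-keys : ∀ {b x y} (q : b ∷ x ≼ y) py {v} → v ∈ spine q py → x ≺ key v × key v ≼ y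
  spine-keys {b} here py v∈ with ∈-tabulate⁻ v∈
  ... | _ , refl = (b , here) , here
  spine-keys {b} (there {c} {y} q) py v∈ with ∈-++⁻ (spine q (parent< c y py)) v∈
  ... | inj₁ v∈spine with spine-keys q _ v∈spine
  ...   | x≺v , v≼y = x≺v , there v≼y
  spine-keys {b} (there q) py v∈ | inj₂ (here refl) = (b , q) , there here
  spine-keys {b} (there q) py v∈ | inj₂ (there v∈inners) with ∈-tabulate⁻ v∈inners
  ... | _ , refl = (b , there q) , here

module _ {d : ℕ} {ℓ : List Bool → ℕ} {k : ℕ} (C : SV d ℓ → Fin k) where

  data Embedding (i : Fin k) (u : Word) : ℕ → Set where
    leaf : Embedding i u 0
    node : ∀ {m} r → u ≼ r → (pr : length r < d) → C (branch r pr) ≡ i →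
           ((c : Bool) → Embedding i (c ∷ r) m) → Embedding i u (suc m)

  shrink : ∀ {i u m m'} → m' ≤ m → Embedding i u m → Embedding i u m'
  shrink z≤n      _                 = leaf
  shrink (s≤s le) (node r q pr c f) = node r q pr c (shrink le ∘ f)

  descend : ∀ {i u u' m} → u ≼ u' → Embedding i u' m → Embedding i u m
  descend p leaf              = leaf
  descend p (node r q pr c f) = node r (≼-trans p q) pr c f

  -- The location in B_d of the vertex with top-down address z (junk when length z ≥ m).
  loc : ∀ {i u m} → Embedding i u m → Word → Word
  loc {u = u} leaf             _       = u
  loc         (node r _ _ _ _) []      = r
  loc         (node _ _ _ _ f) (c ∷ z) = loc (f c) z

  loc-below : ∀ {i u m} (e : Embedding i u m) z → u ≼ loc e z
  loc-below leaf             _       = here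
  loc-below (node _ q _ _ _) []      = q
  loc-below (node _ q _ _ f) (c ∷ z) = ≼-trans q (≺⇒≼ (c , loc-below (f c) z))

  loc-valid : ∀ {i u m} (e : Embedding i u m) z → length z < m → length (loc e z) < d
  loc-valid (node _ _ pr _ _) []      _        = pr
  loc-valid (node _ _ _ _ f)  (c ∷ z) (s≤s lt) = loc-valid (f c) z lt

  loc-colour : ∀ {i u m} (e : Embedding i u m) z (lt : length z < m) →
               C (branch (loc e z) (loc-valid e z lt)) ≡ i
  loc-colour (node _ _ _ col _) []      _        = col
  loc-colour (node _ _ _ _ f)   (c ∷ z) (s≤s lt) = loc-colour (f c) z lt

  loc-child : ∀ {i u m} (e : Embedding i u m) p b → length p < m → b ∷ loc e p ≼ loc e (p ∷ʳ b)
  loc-child (node _ _ _ _ f) []      b _        = loc-below (f b) []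
  loc-child (node _ _ _ _ f) (c ∷ p) b (s≤s lt) = loc-child (f c) p b lt

  owner : ∀ {i u m} → Embedding i u m → Word → Word
  owner leaf             _ = []
  owner (node r _ _ _ f) x with r ≺? x
  ... | yes (c , _) = c ∷ owner (f c) x
  ... | no _        = []

  owner-≼-root : ∀ {i u m x} (e : Embedding i u m) → x ≼ loc e [] → owner e x ≡ []
  owner-≼-root leaf _ = refl
  owner-≼-root {x = x} (node r _ _ _ _) x≼r with r ≺? x
  ... | yes r≺x = ⊥-elim (≺⇒⋡ r≺x x≼r)
  ... | no _    = refl

  owner-loc : ∀ {i u m} (e : Embedding i u m) z → length z < m → owner e (loc e z) ≡ z
  owner-loc (node r _ _ _ _) [] _ with r ≺? r
  ... | yes r≺r = ⊥-elim (≺⇒⋡ r≺r here)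
  ... | no _    = refl
  owner-loc (node r _ _ _ f) (c ∷ z) (s≤s lt) with r ≺? loc (f c) z
  ... | no r⊀  = ⊥-elim (r⊀ (c , loc-below (f c) z))
  ... | yes (c' , q) with ≺-direction q (loc-below (f c) z)
  ...   | refl = cong (c ∷_) (owner-loc (f c) z lt)

  owner-segment : ∀ {i u m x} (e : Embedding i u m) p b →
                  loc e p ≺ x → x ≼ loc e (p ∷ʳ b) → owner e x ≡ p ∷ʳ b
  owner-segment leaf _ _ u≺x x≼u = ⊥-elim (≺⇒⋡ u≺x x≼u)
  owner-segment {x = x} (node r _ _ _ f) [] b (c , q) x≼rb with r ≺? x
  ... | no r⊀x = ⊥-elim (r⊀x (c , q))
  ... | yes (c' , q')
    with ≺-direction q' q | ≺-direction (≼-trans q x≼rb) (loc-below (f b) [])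
  ...   | refl | refl = cong (c ∷_) (owner-≼-root (f c) x≼rb)
  owner-segment {x = x} (node r _ _ _ f) (c ∷ p) b p≺x x≼pb with r ≺? x
  ... | no r⊀x = ⊥-elim (r⊀x (c , ≼-trans (loc-below (f c) p) (≺⇒≼ p≺x)))
  ... | yes (c' , q')
    with ≺-direction q' (≼-trans (loc-below (f c) p) (≺⇒≼ p≺x))
  ...   | refl = cong (c ∷_) (owner-segment (f c) p b p≺x x≼pb)

  module Realise {i u m} (e : Embedding i u m) where

    reverse-< : ∀ (w : Word) → length w < m → length (reverse w) < m
    reverse-< w = subst (_< m) (sym (length-reverse w))

    -- Vertices of B_m are words read bottom-up, while loc reads addresses top-down.
    φ : BV m → SV d ℓ
    φ (w , lt) = branch (loc e (reverse w)) (loc-valid e (reverse w) (reverse-< w lt))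

    edge : ∀ b w → length (b ∷ w) < m → b ∷ loc e (reverse w) ≼ loc e (reverse (b ∷ w))
    edge b w lt = subst (λ z → b ∷ loc e (reverse w) ≼ loc e z) (sym (unfold-reverse b w))
                        (loc-child e (reverse w) b (reverse-< w (parent< b w lt)))

    path : (b : Bool) (w : Word) → length (b ∷ w) < m → List (SV d ℓ)
    path b w lt = spine (edge b w lt) (loc-valid e (reverse (b ∷ w)) (reverse-< (b ∷ w) lt))

    path-walk : ∀ b w (lt : length (b ∷ w) < m) →
                Walk Down (φ (w , parent< b w lt)) (path b w lt) (φ (b ∷ w , lt))
    path-walk b w lt = spine-walk (edge b w lt) _ _

    address-injective : ∀ w w' → length w < m → length w' < m →
                        loc e (reverse w) ≡ loc e (reverse w') → w ≡ w'
    address-injective w w' lt lt' eq = reverse-injective (begin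
      reverse w                      ≡⟨ sym (owner-loc e (reverse w) (reverse-< w lt)) ⟩
      owner e (loc e (reverse w))    ≡⟨ cong (owner e) eq ⟩
      owner e (loc e (reverse w'))   ≡⟨ owner-loc e (reverse w') (reverse-< w' lt') ⟩
      reverse w'                     ∎)
      where open ≡-Reasoning

    path-owner : ∀ b w lt {v} → v ∈ path b w lt → owner e (key v) ≡ reverse (b ∷ w)
    path-owner b w lt {v} v∈ with spine-keys (edge b w lt) _ v∈
    ... | x≺v , v≼y = trans
      (owner-segment e (reverse w) b x≺v (subst (λ z → key v ≼ loc e z) (unfold-reverse b w) v≼y))
      (sym (unfold-reverse b w))

    path-avoid : ∀ b w lt v → v ∈ path b w lt → ∀ x → φ x ≢ v
    path-avoid b w lt _ v∈ (z , lz) refl = <-irrefl (cong (branch-depth {d = d} ∘ loc e ∘ reverse) z≡bw) below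
      where
      z≡bw : z ≡ b ∷ w
      z≡bw = reverse-injective (trans (sym (owner-loc e (reverse z) (reverse-< z lz))) (path-owner b w lt v∈))
      below : depth (φ (z , lz)) < depth (φ (b ∷ w , lt))
      below = All.lookup (Walk-interior-below depth Step-depth (path-walk b w lt)) v∈

    subdivision : SubdivIn m (Bstar d ℓ) (λ v → C v ≡ i)
    subdivision = record
      { φ          = φ
      ; φ-inj      = λ { (w , lt) (w' , lt') eq → address-injective w w' lt lt' (cong key eq) }
      ; φ-col      = λ { (w , lt) → loc-colour e (reverse w) (reverse-< w lt) }
      ; path       = path
      ; path-walk  = λ b w lt → Walk-Down⇒Walk {d = d} {ℓ} {xs = path b w lt} (path-walk b w lt)
      ; path-uniq  = λ b w lt → Walk-unique depth Step-depth (path-walk b w lt)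
      ; path-avoid = path-avoid
      ; path-disj  = λ b w lt b' w' lt' ne v v∈ v∈' →
          ne (reverse-injective (trans (sym (path-owner b w lt v∈)) (path-owner b' w' lt' v∈')))
      }

  Profile : Word → Vec ℕ k → Set
  Profile u a = ∀ i → Embedding i u (lookup a i)

  Profile-increment : ∀ {u} a j → Profile u a → Embedding j u (suc (lookup a j)) →
                      Profile u (updateAt a j suc)
  Profile-increment {u} a j E Ej i with i ≟ᶠ j
  ... | yes refl = subst (Embedding i u) (sym (lookup∘updateAt i a)) Ej
  ... | no i≢j   = subst (Embedding i u) (sym (lookup∘updateAt′ i j i≢j a)) (E i)

  Profile-descend : ∀ {b u} a → Profile (b ∷ u) a → Profile u a
  Profile-descend _ E i = descend (there here) (E i)

  profile : ∀ n u → n + length u ≡ d → ∃ λ (a : Vec ℕ k) → sum a ≡ n × Profile u a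
  profile zero u _ =
    replicate k 0 , sum-replicate-zero k , λ i → subst (Embedding i u) (sym (lookup-replicate i 0)) leaf
  profile (suc n) u n+|u|≡d
    with profile n (true ∷ u) (trans (+-suc n (length u)) n+|u|≡d)
       | profile n (false ∷ u) (trans (+-suc n (length u)) n+|u|≡d)
  ... | L , ΣL≡n , EL | R , ΣR≡n , ER with any? (λ j → lookup R j <? lookup L j)
  ...   | yes (j , R<L) =
    updateAt R j suc , trans (sum-updateAt-suc R j) (cong suc ΣR≡n) ,
    Profile-increment R j (Profile-descend R ER) (descend (there here) (shrink R<L (EL j)))
  ...   | no R≮L =
    updateAt L c suc , trans (sum-updateAt-suc L c) (cong suc ΣL≡n) ,
    Profile-increment L c (Profile-descend L EL) (node u here pu refl children)
    where
    pu : length u < d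
    pu = subst (length u <_) n+|u|≡d (s≤s (m≤n+m (length u) n))
    c : Fin k
    c = C (branch u pu)
    children : (b : Bool) → Embedding c (b ∷ u) (lookup L c)
    children true  = EL c
    children false = shrink (≮⇒≥ (R≮L ∘ (c ,_))) (ER c)

lemma1 : (d k : ℕ) → 1 ≤ d → (ℓ : List Bool → ℕ) → (C : V (Bstar d ℓ) → Fin k) →
    ∃ λ (a : Vec ℕ k) → sum a ≡ d ×
    (∀ (i : Fin k) → SubdivIn (lookup a i) (Bstar d ℓ) (λ v → C v ≡ i))
lemma1 d k _ ℓ C with profile C d [] (+-identityʳ d)
... | a , Σa≡d , E = a , Σa≡d , λ i → Realise.subdivision C (E i)
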